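{- Let $n$ be a positive integer and let $\Gamma$ be either $C_\infty\cdot\overline{K_n}$ or $C_\infty\cdot K_n$. Every reduced coloring of $\Gamma$ is block-monochrome, i.e. all vertices of each block $V_i$ have the same color.
   Context: $\Gamma$ has vertices $v_{ij}$, $i\in\mathbb Z$, $1\le j\le n$; in $C_\infty\cdot\overline{K_n}$, $v_{ij}\sim v_{i'j'}$ iff $|i-i'|=1$; in $C_\infty\cdot K_n$, $v_{ij}\sim v_{i'j'}$ iff $|i-i'|=1$, or $i=i'$ and $j\neq j'$. The block $V_i$ is $\{v_{i1},\dots,v_{in}\}$. A coloring with finitely many colors is perfect if every vertex of color $a$ has exactly $m_{ab}$ neighbours of color $b$, for a fixed matrix $(m_{ab})$. For a perfect coloring $\psi$ of $\Gamma$, two colors are equivalent if identifying them yields a perfect coloring; this is an equivalence relation on the colors of $\psi$. The coloring obtained from $\psi$ by identifying all colors within each equivalence class is called a reduced coloring, and $\psi$ is called a splitting of it. -}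

module Defs where

open import Data.Nat using (ℕ; suc)
open import Data.Integer as ℤ using (ℤ; ∣_∣; _-_; _+_; -[1+_]; +_)
import Data.Integer.Properties as ℤP
open import Data.Fin using (Fin)
import Data.Fin.Properties as FinP
open import Data.Nat.Properties using () renaming (_≟_ to _≟ℕ_)
open import Data.List using (List; length; filter; map; concatMap; _∷_; [])
open import Data.List using () renaming (allFin to allFinL)
open import Data.Product using (_×_; _,_; Σ; ∃)
open import Data.Sum using (_⊎_)
open import Relation.Nullary using (¬_; Dec; yes; no)
open import Relation.Nullary.Decidable using (_×-dec_; _⊎-dec_; ¬?)
open import Relation.Binary.PropositionalEquality using (_≡_)
open import Function.Bundles using (_⇔_)

data GraphType : Set where
  CinfKnbar : GraphType
  CinfKn    : GraphType

-- vertex v_{ij} is the pair (i , j), i ∈ ℤ, j ∈ Fin n (j ranges over 1..n)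
Vertex : ℕ → Set
Vertex n = ℤ × Fin n

Adj : (t : GraphType) (n : ℕ) → Vertex n → Vertex n → Set
Adj CinfKnbar n (i , j) (i' , j') = ∣ i - i' ∣ ≡ 1
Adj CinfKn    n (i , j) (i' , j') = (∣ i - i' ∣ ≡ 1) ⊎ ((i ≡ i') × ¬ (j ≡ j'))

adj? : (t : GraphType) (n : ℕ) (v w : Vertex n) → Dec (Adj t n v w)
adj? CinfKnbar n (i , j) (i' , j') = ∣ i - i' ∣ ≟ℕ 1
adj? CinfKn    n (i , j) (i' , j') =
  (∣ i - i' ∣ ≟ℕ 1) ⊎-dec ((i ℤP.≟ i') ×-dec ¬? (j FinP.≟ j'))

-- Every neighbour of v_{ij} lies in blocks V_{i-1}, V_i, V_{i+1};
-- this list enumerates those 3n vertices, each exactly once.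
candidates : (n : ℕ) → Vertex n → List (Vertex n)
candidates n (i , _) =
  concatMap (λ d → map (λ j' → (i + d , j')) (allFinL n)) (-[1+ 0 ] ∷ + 0 ∷ + 1 ∷ [])

nbrCount : (t : GraphType) (n k : ℕ) → (Vertex n → Fin k) → Vertex n → Fin k → ℕ
nbrCount t n k ψ v b =
  length (filter (λ w → adj? t n v w ×-dec (ψ w FinP.≟ b)) (candidates n v))

Perfect : (t : GraphType) (n k : ℕ) → (Vertex n → Fin k) → Set
Perfect t n k ψ = Σ (Fin k → Fin k → ℕ) λ m →
  ∀ (v : Vertex n) (b : Fin k) → nbrCount t n k ψ v b ≡ m (ψ v) b

merge : ∀ {k} → Fin k → Fin k → Fin k → Fin k
merge a b c with c FinP.≟ b
... | yes _ = a
... | no _  = c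

ColEquiv : (t : GraphType) (n k : ℕ) → (Vertex n → Fin k) → Fin k → Fin k → Set
ColEquiv t n k ψ a b = Perfect t n k (λ v → merge a b (ψ v))

-- φ is a reduced colouring: it is obtained from a perfect colouring ψ by
-- identifying all colours within each equivalence class (up to renaming of
-- colours: φ v = φ w iff ψ v and ψ w are equivalent colours).
Reduced : (t : GraphType) (n m : ℕ) → (Vertex n → Fin m) → Set
Reduced t n m φ = Σ ℕ λ k → Σ (Vertex n → Fin k) λ ψ →
  Perfect t n k ψ ×
  (∀ (v w : Vertex n) → (φ v ≡ φ w) ⇔ ColEquiv t n k ψ (ψ v) (ψ w))

BlockMonochrome : (n m : ℕ) → (Vertex n → Fin m) → Set
BlockMonochrome n m φ = ∀ (i : ℤ) (j j' : Fin n) → φ (i , j) ≡ φ (i , j')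

-- Two vertices v_ij, v_ij' of a block are twins: they have the same neighbours
-- apart from each other (and in C∞·K_n they are adjacent to each other). Hence
-- once their colours a and b are identified, both see the same colour counts.
-- These counts are the rows a and b of ψ's matrix with columns a and b added,
-- so the merged colouring is perfect: a and b are equivalent, and a reduced
-- colouring gives v_ij and v_ij' the same colour.
module Submission where

open import Defs
open import Data.Nat using (ℕ; _≥_; _+_; suc)
import Data.Nat.Properties as ℕP
open import Data.Fin using (Fin) renaming (zero to fzero; suc to fsuc)
open import Data.Fin.Properties using (_≟_; suc-injective)
open import Data.Integer using (ℤ; ∣_∣; -[1+_]; +_) renaming (_+_ to _+ℤ_)
import Data.Integer.Properties as ℤP
open import Algebra.Properties.AbelianGroup ℤP.+-0-abelianGroup using (identityʳ-unique)
open import Data.List using (List; []; _∷_; [_]; _++_; map; filter; length; allFin)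
import Data.List.Properties as List
open import Data.List.Relation.Unary.All using (universal)
open import Data.Product using (_×_; _,_; proj₁; map₁; map₂)
open import Data.Sum using (_⊎_; inj₁; inj₂)
open import Data.Empty using (⊥-elim)
open import Function using (_∘_)
open import Function.Bundles using (Equivalence)
open import Level using (0ℓ)
open import Relation.Nullary using (¬_; yes; no)
open import Relation.Nullary.Decidable using (_×-dec_; _⊎-dec_; ¬?)
open import Relation.Unary using (Pred; Decidable; _≐_)
open import Relation.Binary.PropositionalEquality hiding ([_])

private
  variable
    A B : Set
    n k : ℕ

count : {P : Pred A 0ℓ} → Decidable P → List A → ℕ
count P? xs = length (filter P? xs)

count-≐ : {P Q : Pred A 0ℓ} (P? : Decidable P) (Q? : Decidable Q) → P ≐ Q →
  ∀ xs → count P? xs ≡ count Q? xs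
count-≐ P? Q? P≐Q xs = cong length (List.filter-≐ P? Q? P≐Q xs)

count-++ : {P : Pred A 0ℓ} (P? : Decidable P) → ∀ xs ys →
  count P? (xs ++ ys) ≡ count P? xs + count P? ys
count-++ P? xs ys =
  trans (cong length (List.filter-++ P? xs ys)) (List.length-++ (filter P? xs))

count-none : {P : Pred A 0ℓ} (P? : Decidable P) → (∀ x → ¬ P x) → ∀ xs → count P? xs ≡ 0
count-none P? ¬P xs = cong length (List.filter-none P? (universal ¬P xs))

count-map : {P : Pred B 0ℓ} (P? : Decidable P) (f : A → B) →
  ∀ xs → count P? (map f xs) ≡ count (P? ∘ f) xs
count-map P? f [] = refl
count-map P? f (x ∷ xs) with P? (f x)
... | yes _ = cong suc (count-map P? f xs)
... | no _  = count-map P? f xs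

count-⊎ : {P Q : Pred A 0ℓ} (P? : Decidable P) (Q? : Decidable Q) → (∀ x → P x → ¬ Q x) →
  ∀ xs → count (λ x → P? x ⊎-dec Q? x) xs ≡ count P? xs + count Q? xs
count-⊎ P? Q? disjoint [] = refl
count-⊎ P? Q? disjoint (x ∷ xs) with P? x | Q? x
... | yes p | yes q = ⊥-elim (disjoint x p q)
... | yes _ | no _  = cong suc (count-⊎ P? Q? disjoint xs)
... | no _  | yes _ =
  trans (cong suc (count-⊎ P? Q? disjoint xs)) (sym (ℕP.+-suc _ _))
... | no _  | no _  = count-⊎ P? Q? disjoint xs

count-split : {P Q : Pred A 0ℓ} (P? : Decidable P) (Q? : Decidable Q) → ∀ xs →
  count Q? xs ≡ count (λ x → ¬? (P? x) ×-dec Q? x) xs + count (λ x → P? x ×-dec Q? x) xs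
count-split {P = P} {Q = Q} P? Q? xs =
  trans (count-≐ Q? _ (byCases , fromCases) xs)
        (count-⊎ _ _ (λ _ (¬p , _) (p , _) → ¬p p) xs)
  where
  byCases : ∀ {x} → Q x → (¬ P x × Q x) ⊎ (P x × Q x)
  byCases {x} q with P? x
  ... | yes p = inj₂ (p , q)
  ... | no ¬p = inj₁ (¬p , q)
  fromCases : ∀ {x} → (¬ P x × Q x) ⊎ (P x × Q x) → Q x
  fromCases (inj₁ (_ , q)) = q
  fromCases (inj₂ (_ , q)) = q

allFin-suc : allFin (suc n) ≡ fzero ∷ map fsuc (allFin n)
allFin-suc = cong (fzero ∷_) (sym (List.map-tabulate (λ x → x) fsuc))

count-allFin-≡ : (j : Fin n) → count (j ≟_) (allFin n) ≡ 1
count-allFin-≡ {suc n} fzero = begin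
  count (fzero ≟_) (allFin (suc n))          ≡⟨ cong (count (fzero ≟_)) (allFin-suc {n}) ⟩
  suc (count (fzero ≟_) (map fsuc (allFin n))) ≡⟨ cong suc (count-map (fzero ≟_) fsuc (allFin n)) ⟩
  suc (count (λ x → fzero ≟ fsuc x) (allFin n)) ≡⟨ cong suc (count-none _ (λ _ ()) (allFin n)) ⟩
  1                                          ∎
  where open ≡-Reasoning
count-allFin-≡ {suc n} (fsuc j) = begin
  count (fsuc j ≟_) (allFin (suc n))        ≡⟨ cong (count (fsuc j ≟_)) (allFin-suc {n}) ⟩
  count (fsuc j ≟_) (map fsuc (allFin n))   ≡⟨ count-map (fsuc j ≟_) fsuc (allFin n) ⟩
  count (λ x → fsuc j ≟ fsuc x) (allFin n)  ≡⟨ count-≐ _ (j ≟_) (suc-injective , cong fsuc) (allFin n) ⟩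
  count (j ≟_) (allFin n)                   ≡⟨ count-allFin-≡ j ⟩
  1                                         ∎
  where open ≡-Reasoning

count-allFin-at : {Q : Pred (Fin n) 0ℓ} (Q? : Decidable Q) (j : Fin n) →
  count (λ x → (j ≟ x) ×-dec Q? x) (allFin n) ≡ count Q? [ j ]
count-allFin-at Q? j with Q? j
... | yes q = trans (count-≐ _ (j ≟_) (proj₁ , λ { refl → refl , q }) (allFin _))
                    (count-allFin-≡ j)
... | no ¬q = count-none (λ x → (j ≟ x) ×-dec Q? x) (λ { _ (refl , q) → ¬q q }) (allFin _)

count-allFin-except : {Q : Pred (Fin n) 0ℓ} (Q? : Decidable Q) (j : Fin n) →
  count (λ x → ¬? (j ≟ x) ×-dec Q? x) (allFin n) + count Q? [ j ] ≡ count Q? (allFin n)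
count-allFin-except Q? j = sym (trans (count-split (j ≟_) Q? (allFin _))
  (cong (_+_ (count (λ x → ¬? (j ≟ x) ×-dec Q? x) (allFin _))) (count-allFin-at Q? j)))

block : (n : ℕ) → ℤ → List (Vertex n)
block n i = map (i ,_) (allFin n)

nbrCountIn : (t : GraphType) → (Vertex n → Fin k) → Vertex n → Fin k → List (Vertex n) → ℕ
nbrCountIn {n} t χ v y = count (λ w → adj? t n v w ×-dec (χ w ≟ y))

nbrCount-blocks : (t : GraphType) (χ : Vertex n → Fin k) (i : ℤ) (j : Fin n) (y : Fin k) →
  let N = nbrCountIn t χ (i , j) y ∘ block n in
  nbrCount t n k χ (i , j) y ≡ N (i +ℤ -[1+ 0 ]) + (N (i +ℤ + 0) + (N (i +ℤ + 1) + 0))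
nbrCount-blocks {n} t χ i j y = trans (count-++ P? (block n (i +ℤ -[1+ 0 ])) _)
  (cong (_+_ (count P? (block n (i +ℤ -[1+ 0 ])))) (trans (count-++ P? (block n (i +ℤ + 0)) _)
    (cong (_+_ (count P? (block n (i +ℤ + 0)))) (count-++ P? (block n (i +ℤ + 1)) []))))
  where
  P? : Decidable (λ w → Adj t n (i , j) w × χ w ≡ y)
  P? = λ w → adj? t n (i , j) w ×-dec (χ w ≟ y)

shift-≢ : (i d : ℤ) → d ≢ + 0 → i +ℤ d ≢ i
shift-≢ i d d≢0 i+d≡i = d≢0 (identityʳ-unique i d i+d≡i)

adj-otherBlock : {i i' : ℤ} {j j' x : Fin n} → i' ≢ i →
  Adj CinfKn n (i , j) (i' , x) → Adj CinfKn n (i , j') (i' , x)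
adj-otherBlock i'≢i (inj₁ ∣i-i'∣≡1) = inj₁ ∣i-i'∣≡1
adj-otherBlock i'≢i (inj₂ (i≡i' , _)) = ⊥-elim (i'≢i (sym i≡i'))

adj-ownBlock : {i : ℤ} {j x : Fin n} → Adj CinfKn n (i , j) (i , x) → j ≢ x
adj-ownBlock {i = i} (inj₁ ∣i-i∣≡1) with trans (sym (cong ∣_∣ (ℤP.+-inverseʳ i))) ∣i-i∣≡1
... | ()
adj-ownBlock (inj₂ (_ , j≢x)) = j≢x

module _ (χ : Vertex n → Fin k) (i : ℤ) (y : Fin k) where

  nbrCountIn-otherBlock : (i' : ℤ) → i' ≢ i → (j j' : Fin n) →
    nbrCountIn CinfKn χ (i , j) y (block n i') ≡ nbrCountIn CinfKn χ (i , j') y (block n i')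
  nbrCountIn-otherBlock i' i'≢i j j' =
    trans (count-map _ (i' ,_) (allFin n))
      (trans (count-≐ _ _ (map₁ (adj-otherBlock i'≢i) , map₁ (adj-otherBlock i'≢i)) (allFin n))
        (sym (count-map _ (i' ,_) (allFin n))))

  nbrCountIn-ownBlock : (j : Fin n) → nbrCountIn CinfKn χ (i , j) y (block n i) ≡
    count (λ x → ¬? (j ≟ x) ×-dec (χ (i , x) ≟ y)) (allFin n)
  nbrCountIn-ownBlock j = trans (count-map _ (i ,_) (allFin n))
    (count-≐ _ _ (map₁ adj-ownBlock , map₁ (λ j≢x → inj₂ (refl , j≢x))) (allFin n))

  nbrCountIn-ownBlock-twins : (j j' : Fin n) → χ (i , j) ≡ χ (i , j') →
    nbrCountIn CinfKn χ (i , j) y (block n i) ≡ nbrCountIn CinfKn χ (i , j') y (block n i)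
  nbrCountIn-ownBlock-twins j j' χj≡χj' = begin
    nbrCountIn CinfKn χ (i , j) y (block n i)  ≡⟨ nbrCountIn-ownBlock j ⟩
    count (others j) (allFin n)                ≡⟨ ℕP.+-cancelʳ-≡ _ _ _ sameTotal ⟩
    count (others j') (allFin n)               ≡⟨ nbrCountIn-ownBlock j' ⟨
    nbrCountIn CinfKn χ (i , j') y (block n i) ∎
    where
    open ≡-Reasoning
    Q? : Decidable (λ x → χ (i , x) ≡ y)
    Q? = λ x → χ (i , x) ≟ y
    others : (a : Fin n) → Decidable (λ x → a ≢ x × χ (i , x) ≡ y)
    others a x = ¬? (a ≟ x) ×-dec Q? x
    sameTotal : count (others j) (allFin n) + count Q? [ j ]
              ≡ count (others j') (allFin n) + count Q? [ j ]
    sameTotal = begin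
      count (others j) (allFin n) + count Q? [ j ]   ≡⟨ count-allFin-except Q? j ⟩
      count Q? (allFin n)                            ≡⟨ count-allFin-except Q? j' ⟨
      count (others j') (allFin n) + count Q? [ j' ] ≡⟨ cong (_+_ (count (others j') (allFin n))) sameColour ⟩
      count (others j') (allFin n) + count Q? [ j ]  ∎
      where
      sameColour : count Q? [ j' ] ≡ count Q? [ j ]
      sameColour = trans (sym (count-map (_≟ y) (χ ∘ (i ,_)) [ j' ]))
        (trans (cong (λ c → count (_≟ y) [ c ]) (sym χj≡χj')) (count-map (_≟ y) (χ ∘ (i ,_)) [ j ]))

nbrCount-twins : (t : GraphType) (χ : Vertex n → Fin k) (i : ℤ) (j j' : Fin n) →
  χ (i , j) ≡ χ (i , j') → ∀ y → nbrCount t n k χ (i , j) y ≡ nbrCount t n k χ (i , j') y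
nbrCount-twins {n} CinfKnbar χ i j j' _ y =
  count-≐ _ _ ((λ { {_ , _} p → p }) , (λ { {_ , _} p → p })) (candidates n (i , j))
nbrCount-twins {n} CinfKn χ i j j' χj≡χj' y = trans (nbrCount-blocks CinfKn χ i j y)
  (trans (cong₂ _+_ (nbrCountIn-otherBlock χ i y _ (shift-≢ i -[1+ 0 ] (λ ())) j j')
           (cong₂ _+_ ownBlock
             (cong (_+ 0) (nbrCountIn-otherBlock χ i y _ (shift-≢ i (+ 1) (λ ())) j j'))))
    (sym (nbrCount-blocks CinfKn χ i j' y)))
  where
  ownBlock : nbrCountIn CinfKn χ (i , j) y (block n (i +ℤ + 0))
           ≡ nbrCountIn CinfKn χ (i , j') y (block n (i +ℤ + 0))
  ownBlock rewrite ℤP.+-identityʳ i = nbrCountIn-ownBlock-twins χ i y j j' χj≡χj'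

merge-cases : (a b c : Fin k) {y : Fin k} → merge a b c ≡ y → (c ≢ b × c ≡ y) ⊎ (c ≡ b × a ≡ y)
merge-cases a b c eq with c ≟ b
... | yes c≡b = inj₂ (c≡b , eq)
... | no c≢b  = inj₁ (c≢b , eq)

merge-≢ : {a b c : Fin k} → c ≢ b → merge a b c ≡ c
merge-≢ {b = b} {c} c≢b with c ≟ b
... | yes c≡b = ⊥-elim (c≢b c≡b)
... | no _    = refl

merge-b : (a b : Fin k) → merge a b b ≡ a
merge-b a b with b ≟ b
... | yes _ = refl
... | no b≢b = ⊥-elim (b≢b refl)

merge-a : (a b : Fin k) → merge a b a ≡ a
merge-a a b with a ≟ b
... | yes _ = refl
... | no _  = refl

merge-self : (a c : Fin k) → merge a a c ≡ c
merge-self a c with c ≟ a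
... | yes c≡a = sym c≡a
... | no _    = refl

merge-identifies : (a b : Fin k) → merge a b a ≡ merge a b b
merge-identifies a b = trans (merge-a a b) (sym (merge-b a b))

mergedCounts : Fin k → Fin k → (Fin k → ℕ) → Fin k → ℕ
mergedCounts a b N y with a ≟ b | y ≟ b | y ≟ a
... | yes _ | _     | _     = N y
... | no _  | yes _ | _     = 0
... | no _  | no _  | yes _ = N a + N b
... | no _  | no _  | no _  = N y

mergedCounts-cong : (a b : Fin k) {N N' : Fin k → ℕ} → (∀ c → N c ≡ N' c) →
  ∀ y → mergedCounts a b N y ≡ mergedCounts a b N' y
mergedCounts-cong a b N≗N' y with a ≟ b | y ≟ b | y ≟ a
... | yes _ | _     | _     = N≗N' y
... | no _  | yes _ | _     = refl
... | no _  | no _  | yes _ = cong₂ _+_ (N≗N' a) (N≗N' b)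
... | no _  | no _  | no _  = N≗N' y

count-merge : {P : Pred A 0ℓ} (P? : Decidable P) (ψ : A → Fin k) (a b y : Fin k) → ∀ xs →
  count (λ x → P? x ×-dec (merge a b (ψ x) ≟ y)) xs
    ≡ mergedCounts a b (λ c → count (λ x → P? x ×-dec (ψ x ≟ c)) xs) y
count-merge {P = P} P? ψ a b y xs with a ≟ b | y ≟ b | y ≟ a
... | yes refl | _ | _ =
  count-≐ _ _ (map₂ (trans (sym (merge-self a _))) , map₂ (trans (merge-self a _))) xs
... | no a≢b | yes refl | _ =
  count-none (λ x → P? x ×-dec (merge a b (ψ x) ≟ b)) (λ x (_ , eq) → notB (ψ x) eq) xs
  where
  notB : ∀ c → merge a b c ≢ b
  notB c eq with merge-cases a b c eq
  ... | inj₁ (c≢b , c≡b) = c≢b c≡b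
  ... | inj₂ (_ , a≡b)   = a≢b a≡b
... | no a≢b | no _ | yes refl = trans (count-≐ _ _ (toEither , fromEither) xs)
  (count-⊎ _ _ (λ { _ (_ , ψx≡a) (_ , ψx≡b) → a≢b (trans (sym ψx≡a) ψx≡b) }) xs)
  where
  toEither : ∀ {x} → P x × merge a b (ψ x) ≡ a → (P x × ψ x ≡ a) ⊎ (P x × ψ x ≡ b)
  toEither {x} (p , eq) with merge-cases a b (ψ x) eq
  ... | inj₁ (_ , ψx≡a) = inj₁ (p , ψx≡a)
  ... | inj₂ (ψx≡b , _) = inj₂ (p , ψx≡b)
  fromEither : ∀ {x} → (P x × ψ x ≡ a) ⊎ (P x × ψ x ≡ b) → P x × merge a b (ψ x) ≡ a
  fromEither (inj₁ (p , refl)) = p , merge-≢ a≢b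
  fromEither (inj₂ (p , refl)) = p , merge-b a b
... | no _ | no y≢b | no y≢a =
  count-≐ _ _ (map₂ toSame , map₂ λ { refl → merge-≢ y≢b }) xs
  where
  toSame : ∀ {c} → merge a b c ≡ y → c ≡ y
  toSame {c} eq with merge-cases a b c eq
  ... | inj₁ (_ , c≡y) = c≡y
  ... | inj₂ (_ , a≡y) = ⊥-elim (y≢a (sym a≡y))

mergedRows⇒colEquiv : (t : GraphType) (ψ : Vertex n → Fin k) (a b : Fin k)
  (mat : Fin k → Fin k → ℕ) → (∀ v c → nbrCount t n k ψ v c ≡ mat (ψ v) c) →
  (∀ y → mergedCounts a b (mat a) y ≡ mergedCounts a b (mat b) y) → ColEquiv t n k ψ a b
mergedRows⇒colEquiv {n} {k} t ψ a b mat perfect sameRows =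
  (λ x → mergedCounts a b (mat x)) , λ v y → begin
    nbrCount t n k (merge a b ∘ ψ) v y         ≡⟨ count-merge (adj? t n v) ψ a b y (candidates n v) ⟩
    mergedCounts a b (nbrCount t n k ψ v) y    ≡⟨ mergedCounts-cong a b (perfect v) y ⟩
    mergedCounts a b (mat (ψ v)) y             ≡⟨ rowOfMerged (ψ v) y ⟩
    mergedCounts a b (mat (merge a b (ψ v))) y ∎
  where
  open ≡-Reasoning
  rowOfMerged : ∀ c y → mergedCounts a b (mat c) y ≡ mergedCounts a b (mat (merge a b c)) y
  rowOfMerged c y with c ≟ b
  ... | yes refl = sym (sameRows y)
  ... | no _     = refl

sameBlock-colEquiv : (t : GraphType) (ψ : Vertex n → Fin k) → Perfect t n k ψ →
  ∀ i j j' → ColEquiv t n k ψ (ψ (i , j)) (ψ (i , j'))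
sameBlock-colEquiv {n} {k} t ψ (mat , perfect) i j j' =
  mergedRows⇒colEquiv t ψ a b mat perfect λ y → begin
    mergedCounts a b (mat a) y                     ≡⟨ mergedCounts-cong a b (perfect (i , j)) y ⟨
    mergedCounts a b (nbrCount t n k ψ (i , j)) y  ≡⟨ mergedNbrCount (i , j) y ⟨
    nbrCount t n k merged (i , j) y                ≡⟨ nbrCount-twins t merged i j j' (merge-identifies a b) y ⟩
    nbrCount t n k merged (i , j') y               ≡⟨ mergedNbrCount (i , j') y ⟩
    mergedCounts a b (nbrCount t n k ψ (i , j')) y ≡⟨ mergedCounts-cong a b (perfect (i , j')) y ⟩
    mergedCounts a b (mat b) y                     ∎
  where
  open ≡-Reasoning
  a b : Fin k
  a = ψ (i , j)
  b = ψ (i , j')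
  merged : Vertex n → Fin k
  merged = merge a b ∘ ψ
  mergedNbrCount : ∀ v y → nbrCount t n k merged v y ≡ mergedCounts a b (nbrCount t n k ψ v) y
  mergedNbrCount v y = count-merge (adj? t n v) ψ a b y (candidates n v)

lemma3 : (n : ℕ) → n ≥ 1 → (t : GraphType) (m : ℕ) (φ : Vertex n → Fin m) →
    Reduced t n m φ → BlockMonochrome n m φ
lemma3 n _ t m φ (k , ψ , perfect , sameColour⇔equivalent) i j j' =
  Equivalence.from (sameColour⇔equivalent (i , j) (i , j'))
    (sameBlock-colEquiv t ψ perfect i j j')
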